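{- For $n \in \mathbb{N}$ let $\rho_n := \prod_{p \text{ prime}} p^{\lfloor n/p \rfloor}$ and $\sigma_n := \prod_{p \text{ prime}} p^{\lfloor n/(p-1) \rfloor}$. Then for every $n \in \mathbb{N}$: (i) $\rho_n \mid \rho_{n+1}$, $\sigma_n \mid \sigma_{n+1}$, and $\rho_n \mid \sigma_n$; (ii) $\rho_n \mid n!$; (iii) $n! \mid \sigma_n$ and $\sigma_n \mid (2n)!$; (iv) $\sigma_{2n+1} = 2\sigma_{2n}$.
   Context: $\lfloor\cdot\rfloor$ is the floor function; products are over all primes $p$ (only finitely many factors differ from $1$). -}

module Defs where

open import Data.Nat using (ℕ; zero; suc; _*_; _^_; _∸_; _/_)
open import Data.Nat.Primality using (prime?)
open import Relation.Nullary using (yes; no)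

primeProd : ℕ → (ℕ → ℕ) → ℕ
primeProd zero    e = 1
primeProd (suc m) e with prime? (suc m)
... | yes _ = (suc m) ^ e (suc m) * primeProd m e
... | no  _ = primeProd m e

-- exponent ⌊ n / p ⌋ (p = 0 irrelevant: not prime; value set to 0)
ρExp : ℕ → ℕ → ℕ
ρExp n zero    = 0
ρExp n (suc k) = n / suc k

-- exponent ⌊ n / (p - 1) ⌋ (p ≤ 1 irrelevant: not prime; value set to 0)
σExp : ℕ → ℕ → ℕ
σExp n zero          = 0
σExp n (suc zero)    = 0
σExp n (suc (suc k)) = n / suc k

-- ρ_n = ∏_p p^⌊n/p⌋ ; only primes p ≤ n contribute nontrivially,
-- so the product over primes p ≤ n + 1 is the full product.
ρ : ℕ → ℕ
ρ n = primeProd (suc n) (ρExp n)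

-- σ_n = ∏_p p^⌊n/(p-1)⌋ ; only primes p ≤ n + 1 contribute nontrivially.
σ : ℕ → ℕ
σ n = primeProd (suc n) (σExp n)

-- Everything is compared prime by prime. Among 1, …, n the multiples of p give
-- p ^ ⌊n/p⌋ ∣ n!, and as ⌊n/(p-1)⌋·p ≤ 2n also p ^ ⌊n/(p-1)⌋ ∣ (2n)!.
-- Conversely n! = p ^ q · q! · R with q = ⌊n/p⌋ and p ∤ R, so by induction every
-- p ^ k ∣ n! has k(p-1) ≤ n (Legendre); as divisibility is decided by prime
-- powers, n! ∣ σ_n. For (iv): p - 1 is even for odd p, so ⌊(2n+1)/(p-1)⌋ =
-- ⌊2n/(p-1)⌋; only the exponent of 2 grows, by one, and 2n + 2 is not prime.

module Submission where

open import Defs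
open import Data.Nat using (ℕ; zero; suc; pred; _*_; _+_; _!; _^_; _∸_; _/_; _%_; _≤_; _<_; _≟_; _≤?_; z≤n; s≤s; s≤s⁻¹; NonZero; nonTrivial⇒n>1)
open import Data.Nat.Properties
open import Data.Nat.Divisibility
open import Data.Nat.DivMod
open import Data.Nat.Induction using (<-rec)
open import Data.Nat.Primality
open import Data.Nat.Primality.Factorisation using (factorise)
open import Data.Nat.ListAction using (product)
open import Data.Nat.Tactic.RingSolver using (solve-∀)
open import Algebra.Properties.CommutativeSemigroup *-commutativeSemigroup using (x∙yz≈y∙xz; x∙yz≈z∙xy)
open import Data.List.Base using (_∷_)
open import Data.List.Relation.Unary.All using (All; []; _∷_)
open import Data.Product using (_×_; _,_; ∃-syntax)
open import Data.Sum using (inj₁; inj₂; _⊎_)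
open import Relation.Nullary using (¬_; yes; no)
open import Relation.Nullary.Negation using (contradiction)
open import Relation.Binary.PropositionalEquality
open import Function.Base using (_∘_)

private
  variable
    m n p : ℕ
    e f : ℕ → ℕ

prime∤1 : Prime p → ¬ p ∣ 1
prime∤1 pp p∣1 = ¬prime[1] (subst Prime (∣1⇒≡1 p∣1) pp)

prime∣prime⇒≡ : ∀ {p q} → Prime p → Prime q → p ∣ q → p ≡ q
prime∣prime⇒≡ pp pq p∣q with prime⇒irreducible pq p∣q
... | inj₁ p≡1 = contradiction (subst Prime p≡1 pp) ¬prime[1]
... | inj₂ p≡q = p≡q

prime∣^⇒≡ : ∀ {p q} → Prime p → Prime q → ∀ k → p ∣ q ^ k → p ≡ q
prime∣^⇒≡ pp pq zero p∣1 = contradiction p∣1 (prime∤1 pp)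
prime∣^⇒≡ {q = q} pp pq (suc k) p∣q^1+k with euclidsLemma q (q ^ k) pp p∣q^1+k
... | inj₁ p∣q   = prime∣prime⇒≡ pp pq p∣q
... | inj₂ p∣q^k = prime∣^⇒≡ pp pq k p∣q^k

^-monoʳ-∣ : ∀ p → m ≤ n → p ^ m ∣ p ^ n
^-monoʳ-∣ p z≤n       = 1∣ _
^-monoʳ-∣ p (s≤s m≤n) = *-monoʳ-∣ p (^-monoʳ-∣ p m≤n)

p∤m⇒p^k∣m*n⇒p^k∣n : Prime p → ¬ p ∣ m → ∀ k → p ^ k ∣ m * n → p ^ k ∣ n
p∤m⇒p^k∣m*n⇒p^k∣n {n = n} pp p∤m zero _ = 1∣ n
p∤m⇒p^k∣m*n⇒p^k∣n {p} {m} pp p∤m (suc k) p^1+k∣mn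
  with euclidsLemma m _ pp (m*n∣⇒m∣ p (p ^ k) p^1+k∣mn)
... | inj₁ p∣m = contradiction p∣m p∤m
... | inj₂ (divides n′ refl) =
  ∣-trans (*-monoʳ-∣ p p^k∣n′) (∣-reflexive (*-comm p n′))
  where
  instance _ = prime⇒nonZero pp
  p^k∣n′ : p ^ k ∣ n′
  p^k∣n′ = p∤m⇒p^k∣m*n⇒p^k∣n pp p∤m k
    (*-cancelˡ-∣ p (subst (p * p ^ k ∣_) (x∙yz≈z∙xy m n′ p) p^1+k∣mn))

prime-powers⇒product∣ : ∀ {ps} → All Prime ps →
            (∀ p k → Prime p → p ^ k ∣ product ps → p ^ k ∣ n) → product ps ∣ n
prime-powers⇒product∣ [] _ = 1∣ _
prime-powers⇒product∣ {ps = p ∷ ps} (pp ∷ pps) h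
  with h p 1 pp (*-monoʳ-∣ p (1∣ product ps))
... | divides n′ refl = ∣-trans (*-monoʳ-∣ p (prime-powers⇒product∣ pps h′)) (∣-reflexive (sym n′*p≡p*n′))
  where
  instance _ = prime⇒nonZero pp
  n′*p≡p*n′ : n′ * (p * 1) ≡ p * n′
  n′*p≡p*n′ = trans (cong (n′ *_) (*-identityʳ p)) (*-comm n′ p)
  h′ : ∀ q k → Prime q → q ^ k ∣ product ps → q ^ k ∣ n′
  h′ q k pq q^k∣P with q ≟ p
  ... | yes refl = *-cancelˡ-∣ q (subst (q ^ suc k ∣_) n′*p≡p*n′ (h q (suc k) pq (*-monoʳ-∣ q q^k∣P)))
  ... | no q≢p   = p∤m⇒p^k∣m*n⇒p^k∣n pq (q≢p ∘ prime∣prime⇒≡ pq pp) k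
                     (subst (q ^ k ∣_) n′*p≡p*n′ (h q k pq (∣n⇒∣m*n p q^k∣P)))

prime-powers⇒∣ : .{{NonZero m}} → (∀ p k → Prime p → p ^ k ∣ m → p ^ k ∣ n) → m ∣ n
prime-powers⇒∣ {m} h with factorise m
... | record { factors = ps ; isFactorisation = m≡∏ps ; factorsPrime = pps } =
  subst (_∣ _) (sym m≡∏ps) (prime-powers⇒product∣ pps (λ p k pp → h p k pp ∘ subst (p ^ k ∣_) (sym m≡∏ps)))

primeProd-∣-suc : ∀ m e → primeProd m e ∣ primeProd (suc m) e
primeProd-∣-suc m e with prime? (suc m)
... | yes _ = ∣n⇒∣m*n (suc m ^ e (suc m)) ∣-refl
... | no  _ = ∣-refl

primeProd-mono-∣ : ∀ m → (∀ p → Prime p → e p ≤ f p) → primeProd m e ∣ primeProd m f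
primeProd-mono-∣ zero    e≤f = ∣-refl
primeProd-mono-∣ (suc m) e≤f with prime? (suc m)
... | yes pm = *-pres-∣ (^-monoʳ-∣ (suc m) (e≤f (suc m) pm)) (primeProd-mono-∣ m e≤f)
... | no  _  = primeProd-mono-∣ m e≤f

primeProd-cong : ∀ m → (∀ p → Prime p → p ≤ m → e p ≡ f p) → primeProd m e ≡ primeProd m f
primeProd-cong zero    e≡f = refl
primeProd-cong (suc m) e≡f with prime? (suc m)
... | yes pm = cong₂ _*_ (cong (suc m ^_) (e≡f (suc m) pm ≤-refl))
                         (primeProd-cong m (λ p pp p≤m → e≡f p pp (m≤n⇒m≤1+n p≤m)))
... | no  _  = primeProd-cong m (λ p pp p≤m → e≡f p pp (m≤n⇒m≤1+n p≤m))

primeProd-¬prime : ∀ m → ¬ Prime (suc m) → primeProd (suc m) e ≡ primeProd m e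
primeProd-¬prime m ¬pm with prime? (suc m)
... | yes pm = contradiction pm ¬pm
... | no  _  = refl

prime∤primeProd : Prime p → ∀ m → m < p → ¬ p ∣ primeProd m e
prime∤primeProd pp zero    _   = prime∤1 pp
prime∤primeProd {e = e} pp (suc m) m<p p∣∏ with prime? (suc m)
... | no  _  = prime∤primeProd pp m (<-trans (n<1+n m) m<p) p∣∏
... | yes pm with euclidsLemma (suc m ^ e (suc m)) _ pp p∣∏
...   | inj₁ p∣m^e = <⇒≢ m<p (sym (prime∣^⇒≡ pp pm (e (suc m)) p∣m^e))
...   | inj₂ p∣∏   = prime∤primeProd pp m (<-trans (n<1+n m) m<p) p∣∏

^∣primeProd : Prime p → ∀ m → p ≤ m → p ^ e p ∣ primeProd m e
^∣primeProd pp zero z≤n = contradiction pp ¬prime[0]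
^∣primeProd {e = e} pp (suc m) p≤1+m with prime? (suc m) | m≤n⇒m<n∨m≡n p≤1+m
... | yes _  | inj₂ refl = m∣m*n _
... | no ¬pm | inj₂ refl = contradiction pp ¬pm
... | yes _  | inj₁ p<1+m = ∣n⇒∣m*n (suc m ^ e (suc m)) (^∣primeProd pp m (s≤s⁻¹ p<1+m))
... | no _   | inj₁ p<1+m = ^∣primeProd pp m (s≤s⁻¹ p<1+m)

primeProd-∣ : ∀ m → (∀ p → Prime p → p ≤ m → p ^ e p ∣ n) → primeProd m e ∣ n
primeProd-∣ zero    _   = 1∣ _
primeProd-∣ {e = e} (suc m) h with prime? (suc m) | primeProd-∣ m (λ p pp p≤m → h p pp (m≤n⇒m≤1+n p≤m))
... | no  _  | ∏∣n = ∏∣n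
... | yes pm | divides n′ refl = *-monoˡ-∣ (primeProd m e) m^e∣n′
  where
  m^e∣n′ : suc m ^ e (suc m) ∣ n′
  m^e∣n′ = p∤m⇒p^k∣m*n⇒p^k∣n pm (prime∤primeProd pm m ≤-refl) (e (suc m))
             (subst (suc m ^ e (suc m) ∣_) (*-comm n′ (primeProd m e)) (h (suc m) pm ≤-refl))

primeProd-suc-exponent : Prime p → ∀ m → p ≤ m → f p ≡ suc (e p) →
                         (∀ q → Prime q → q ≢ p → f q ≡ e q) →
                         primeProd m f ≡ p * primeProd m e
primeProd-suc-exponent pp zero z≤n = contradiction pp ¬prime[0]
primeProd-suc-exponent {p} {f} {e} pp (suc m) p≤1+m fp≡1+ep f≡e
  with prime? (suc m) | m≤n⇒m<n∨m≡n p≤1+m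
... | no ¬pm | inj₂ refl = contradiction pp ¬pm
... | yes _  | inj₂ refl = begin
  p ^ f p * primeProd m f        ≡⟨ cong₂ _*_ (cong (p ^_) fp≡1+ep) (primeProd-cong m below-p) ⟩
  p ^ suc (e p) * primeProd m e  ≡⟨ *-assoc p (p ^ e p) (primeProd m e) ⟩
  p * (p ^ e p * primeProd m e)  ∎
  where
  open ≡-Reasoning
  below-p : ∀ q → Prime q → q ≤ m → f q ≡ e q
  below-p q pq q≤m = f≡e q pq (<⇒≢ (s≤s q≤m))
... | no _   | inj₁ p<1+m = primeProd-suc-exponent pp m (s≤s⁻¹ p<1+m) fp≡1+ep f≡e
... | yes pm | inj₁ p<1+m = begin
  suc m ^ f (suc m) * primeProd m f        ≡⟨ cong₂ _*_ (cong (suc m ^_) (f≡e (suc m) pm (<⇒≢ p<1+m ∘ sym)))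
                                                        (primeProd-suc-exponent pp m (s≤s⁻¹ p<1+m) fp≡1+ep f≡e) ⟩
  suc m ^ e (suc m) * (p * primeProd m e)  ≡⟨ x∙yz≈y∙xz (suc m ^ e (suc m)) p (primeProd m e) ⟩
  p * (suc m ^ e (suc m) * primeProd m e)  ∎
  where open ≡-Reasoning

p^q∣[q*p]! : ∀ p q .{{_ : NonZero p}} → p ^ q ∣ (q * p) !
p^q∣[q*p]! p       zero    = ∣-refl
p^q∣[q*p]! (suc p) (suc q) =
  *-pres-∣ (n∣m*n (suc q) {suc p}) (∣-trans (p^q∣[q*p]! (suc p) q) (m≤n⇒m!∣n! (m≤n+m (q * suc p) p)))

p^[n/p]∣n! : ∀ p n .{{_ : NonZero p}} → p ^ (n / p) ∣ n !
p^[n/p]∣n! p n = ∣-trans (p^q∣[q*p]! p (n / p)) (m≤n⇒m!∣n! (m/n*n≤m n p))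

FactorialSplit : ℕ → ℕ → ℕ → Set
FactorialSplit p q n = ∃[ R ] ¬ p ∣ R × n ! ≡ p ^ q * (q ! * R)

p∤m+q*p : .{{NonZero m}} → m < p → ∀ q → ¬ p ∣ m + q * p
p∤m+q*p {m} {p} m<p q p∣m+qp =
  <⇒≱ m<p (∣⇒≤ (∣m+n∣m⇒∣n (subst (p ∣_) (+-comm m (q * p)) p∣m+qp) (n∣m*n q)))

factorial-split : Prime p → ∀ q r → r < p → FactorialSplit p q (r + q * p)
factorial-split {zero}  pp = contradiction pp ¬prime[0]
factorial-split {suc p} pp zero zero _ = 1 , prime∤1 pp , refl
factorial-split {suc p} pp (suc q) zero _ with factorial-split pp q p ≤-refl
... | R , p∤R , eq = R , p∤R , (begin
  suc q * suc p * (p + q * suc p) !        ≡⟨ cong (suc q * suc p *_) eq ⟩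
  suc q * suc p * (suc p ^ q * (q ! * R))  ≡⟨ regroup (suc q) (suc p) (suc p ^ q) (q !) R ⟩
  suc p ^ suc q * (suc q ! * R)            ∎)
  where
  open ≡-Reasoning
  regroup : ∀ a b c d r → a * b * (c * (d * r)) ≡ b * c * (a * d * r)
  regroup = solve-∀
factorial-split {suc p} pp q (suc r) r<p with factorial-split pp q r (<-trans (n<1+n r) r<p)
... | R , p∤R , eq = a * R , p∤aR , (begin
  a * (r + q * suc p) !        ≡⟨ cong (a *_) eq ⟩
  a * (suc p ^ q * (q ! * R))  ≡⟨ x∙yz≈y∙xz a (suc p ^ q) _ ⟩
  suc p ^ q * (a * (q ! * R))  ≡⟨ cong (suc p ^ q *_) (x∙yz≈y∙xz a (q !) R) ⟩
  suc p ^ q * (q ! * (a * R))  ∎)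
  where
  open ≡-Reasoning
  a = suc r + q * suc p
  p∤aR : ¬ suc p ∣ a * R
  p∤aR p∣aR with euclidsLemma a R pp p∣aR
  ... | inj₁ p∣a = p∤m+q*p r<p q p∣a
  ... | inj₂ p∣R = p∤R p∣R

legendre-bound : Prime p → ∀ n k → p ^ k ∣ n ! → k * pred p ≤ n
legendre-bound {p} pp = <-rec (λ n → ∀ k → p ^ k ∣ n ! → k * pred p ≤ n) bound
  where
  instance
    _ = prime⇒nonZero pp
    _ = prime⇒nonTrivial pp
  bound : ∀ n → (∀ {m} → m < n → ∀ k → p ^ k ∣ m ! → k * pred p ≤ m) →
          ∀ k → p ^ k ∣ n ! → k * pred p ≤ n
  bound zero    _ zero    _     = z≤n
  bound zero    _ (suc k) p^k∣1 = contradiction (m*n∣⇒m∣ p _ p^k∣1) (prime∤1 pp)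
  bound n@(suc _) rec k p^k∣n! with factorial-split pp (n / p) (n % p) (m%n<n n p) | k ≤? n / p
  ... | _ | yes k≤q = begin
    k * pred p  ≤⟨ *-monoˡ-≤ (pred p) k≤q ⟩
    q * pred p  ≤⟨ *-monoʳ-≤ q pred[n]≤n ⟩
    q * p       ≤⟨ m/n*n≤m n p ⟩
    n           ∎
    where
    open ≤-Reasoning
    q = n / p
  ... | R , p∤R , eq | no k≰q = begin
    k * pred p                  ≡⟨ cong (_* pred p) (m+[n∸m]≡n q≤k) ⟨
    (q + j) * pred p            ≡⟨ *-distribʳ-+ (pred p) q j ⟩
    q * pred p + j * pred p     ≤⟨ +-monoʳ-≤ (q * pred p) (rec (m/n<m n p (nonTrivial⇒n>1 p)) j p^j∣q!) ⟩
    q * pred p + q              ≡⟨ +-comm (q * pred p) q ⟩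
    q + q * pred p              ≡⟨ *-suc q (pred p) ⟨
    q * suc (pred p)            ≡⟨ cong (q *_) (suc-pred p) ⟩
    q * p                       ≤⟨ m/n*n≤m n p ⟩
    n                           ∎
    where
    open ≤-Reasoning
    q = n / p
    q≤k = <⇒≤ (≰⇒> k≰q)
    j = k ∸ q
    instance _ = m^n≢0 p q
    p^q*p^j∣p^q*[q!*R] : p ^ q * p ^ j ∣ p ^ q * (q ! * R)
    p^q*p^j∣p^q*[q!*R] = subst₂ _∣_
      (trans (cong (p ^_) (sym (m+[n∸m]≡n q≤k))) (^-distribˡ-+-* p q j))
      (trans (cong _! (m≡m%n+[m/n]*n n p)) eq) p^k∣n!
    p^j∣q! : p ^ j ∣ q !
    p^j∣q! = p∤m⇒p^k∣m*n⇒p^k∣n pp p∤R j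
      (subst (p ^ j ∣_) (*-comm (q !) R) (*-cancelˡ-∣ (p ^ q) p^q*p^j∣p^q*[q!*R]))

prime∣n!⇒≤ : Prime p → ∀ n → p ∣ n ! → p ≤ n
prime∣n!⇒≤ pp zero    p∣1 = contradiction p∣1 (prime∤1 pp)
prime∣n!⇒≤ pp (suc n) p∣n! with euclidsLemma (suc n) (n !) pp p∣n!
... | inj₁ p∣1+n = ∣⇒≤ p∣1+n
... | inj₂ p∣n!  = m≤n⇒m≤1+n (prime∣n!⇒≤ pp n p∣n!)

m*n≤o⇒m≤o/n : ∀ m n {o} .{{_ : NonZero n}} → m * n ≤ o → m ≤ o / n
m*n≤o⇒m≤o/n m n m*n≤o = ≤-trans (≤-reflexive (sym (m*n/n≡m m n))) (/-monoˡ-≤ n m*n≤o)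

[r+m]/d≡m/d : ∀ {a r m d} .{{_ : NonZero d}} → a ∣ m → a ∣ d → r < a → (r + m) / d ≡ m / d
[r+m]/d≡m/d {a} {r} {m} a∣m (divides-refl c) r<a = begin
  (r + m) / (c * a)    ≡⟨ /-congʳ (*-comm c a) ⟩
  (r + m) / (a * c)    ≡⟨ m/n/o≡m/[n*o] (r + m) a c ⟨
  (r + m) / a / c      ≡⟨ cong (_/ c) (+-distrib-/-∣ʳ r a∣m) ⟩
  (r / a + m / a) / c  ≡⟨ cong (λ x → (x + m / a) / c) (m<n⇒m/n≡0 r<a) ⟩
  m / a / c            ≡⟨ m/n/o≡m/[n*o] m a c ⟩
  m / (a * c)          ≡⟨ /-congʳ (*-comm a c) ⟩
  m / (c * a)          ∎
  where
  open ≡-Reasoning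
  instance
    c≢0 : NonZero c
    c≢0 = m*n≢0⇒m≢0 c
    a≢0 : NonZero a
    a≢0 = m*n≢0⇒n≢0 c
    a*c≢0 : NonZero (a * c)
    a*c≢0 = m*n≢0 a c

2∣n⊎2∣1+n : ∀ n → 2 ∣ n ⊎ 2 ∣ suc n
2∣n⊎2∣1+n zero    = inj₁ (2 ∣0)
2∣n⊎2∣1+n (suc n) with 2∣n⊎2∣1+n n
... | inj₁ 2∣n   = inj₂ (∣m∣n⇒∣m+n (∣-refl {2}) 2∣n)
... | inj₂ 2∣1+n = inj₁ 2∣1+n

prime≢2⇒2∣pred : Prime p → p ≢ 2 → 2 ∣ pred p
prime≢2⇒2∣pred {zero}  pp _ = contradiction pp ¬prime[0]
prime≢2⇒2∣pred {suc p} pp p≢2 with 2∣n⊎2∣1+n p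
... | inj₁ 2∣p   = 2∣p
... | inj₂ 2∣1+p = contradiction (sym (prime∣prime⇒≡ prime[2] pp 2∣1+p)) p≢2

¬prime[2*m] : 1 < m → ¬ Prime (2 * m)
¬prime[2*m] {m} 1<m pr =
  <⇒≢ 1<m (sym (*-cancelˡ-≡ m 1 2 (sym (prime∣prime⇒≡ prime[2] pr (m∣m*n m)))))

ρExp-mono : m ≤ n → ∀ p → ρExp m p ≤ ρExp n p
ρExp-mono m≤n zero    = z≤n
ρExp-mono m≤n (suc p) = /-monoˡ-≤ (suc p) m≤n

σExp-mono : m ≤ n → ∀ p → σExp m p ≤ σExp n p
σExp-mono m≤n zero          = z≤n
σExp-mono m≤n (suc zero)    = z≤n
σExp-mono m≤n (suc (suc p)) = /-monoˡ-≤ (suc p) m≤n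

ρExp≤σExp : ∀ n p → Prime p → ρExp n p ≤ σExp n p
ρExp≤σExp n zero          pp = contradiction pp ¬prime[0]
ρExp≤σExp n (suc zero)    pp = contradiction pp ¬prime[1]
ρExp≤σExp n (suc (suc p)) _  = /-monoʳ-≤ n (n≤1+n (suc p))

σExp≤[2n]/p : ∀ n p .{{_ : NonZero p}} → σExp n p ≤ (2 * n) / p
σExp≤[2n]/p n (suc zero)    = z≤n
σExp≤[2n]/p n (suc (suc p)) = m*n≤o⇒m≤o/n q (suc (suc p)) (begin
  q * suc (suc p)  ≡⟨ *-suc q (suc p) ⟩
  q + q * suc p    ≤⟨ +-mono-≤ (m/n≤m n (suc p)) (m/n*n≤m n (suc p)) ⟩
  n + n            ≡⟨ cong (n +_) (+-identityʳ n) ⟨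
  2 * n            ∎)
  where
  open ≤-Reasoning
  q = n / suc p

p^k∣n!⇒k≤σExp : Prime p → ∀ n k → p ^ k ∣ n ! → k ≤ σExp n p
p^k∣n!⇒k≤σExp {zero}        pp = contradiction pp ¬prime[0]
p^k∣n!⇒k≤σExp {suc zero}    pp = contradiction pp ¬prime[1]
p^k∣n!⇒k≤σExp {suc (suc p)} pp n k p^k∣n! = m*n≤o⇒m≤o/n k (suc p) (legendre-bound pp n k p^k∣n!)

σExp[1+2n]≡σExp[2n] : ∀ n p → Prime p → p ≢ 2 → σExp (suc (2 * n)) p ≡ σExp (2 * n) p
σExp[1+2n]≡σExp[2n] n zero          pp _   = contradiction pp ¬prime[0]
σExp[1+2n]≡σExp[2n] n (suc zero)    pp _   = contradiction pp ¬prime[1]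
σExp[1+2n]≡σExp[2n] n (suc (suc p)) pp p≢2 =
  [r+m]/d≡m/d (m∣m*n n) (prime≢2⇒2∣pred pp p≢2) (s≤s (s≤s z≤n))

σExp[1+n]2≡1+σExp[n]2 : ∀ n → σExp (suc n) 2 ≡ suc (σExp n 2)
σExp[1+n]2≡1+σExp[n]2 n = trans (n/1≡n (suc n)) (cong suc (sym (n/1≡n n)))

ρ∣ρ[1+n] : ∀ n → ρ n ∣ ρ (suc n)
ρ∣ρ[1+n] n = ∣-trans (primeProd-mono-∣ (suc n) (λ p _ → ρExp-mono (n≤1+n n) p))
                     (primeProd-∣-suc (suc n) (ρExp (suc n)))

σ∣σ[1+n] : ∀ n → σ n ∣ σ (suc n)
σ∣σ[1+n] n = ∣-trans (primeProd-mono-∣ (suc n) (λ p _ → σExp-mono (n≤1+n n) p))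
                     (primeProd-∣-suc (suc n) (σExp (suc n)))

ρ∣σ : ∀ n → ρ n ∣ σ n
ρ∣σ n = primeProd-mono-∣ (suc n) (ρExp≤σExp n)

ρ∣n! : ∀ n → ρ n ∣ n !
ρ∣n! n = primeProd-∣ (suc n) p^ρExp∣n!
  where
  p^ρExp∣n! : ∀ p → Prime p → p ≤ suc n → p ^ ρExp n p ∣ n !
  p^ρExp∣n! zero    pp _ = contradiction pp ¬prime[0]
  p^ρExp∣n! (suc p) _  _ = p^[n/p]∣n! (suc p) n

n!∣σ : ∀ n → n ! ∣ σ n
n!∣σ n = prime-powers⇒∣ {{n !≢0}} p^k∣σ
  where
  p^k∣σ : ∀ p k → Prime p → p ^ k ∣ n ! → p ^ k ∣ σ n
  p^k∣σ p zero    _  _         = 1∣ σ n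
  p^k∣σ p (suc k) pp p^1+k∣n! = ∣-trans (^-monoʳ-∣ p (p^k∣n!⇒k≤σExp pp n (suc k) p^1+k∣n!))
    (^∣primeProd pp (suc n) (m≤n⇒m≤1+n (prime∣n!⇒≤ pp n (m*n∣⇒m∣ p (p ^ k) p^1+k∣n!))))

σ∣[2n]! : ∀ n → σ n ∣ (2 * n) !
σ∣[2n]! n = primeProd-∣ (suc n) p^σExp∣[2n]!
  where
  p^σExp∣[2n]! : ∀ p → Prime p → p ≤ suc n → p ^ σExp n p ∣ (2 * n) !
  p^σExp∣[2n]! p pp _ = ∣-trans (^-monoʳ-∣ p (σExp≤[2n]/p n p)) (p^[n/p]∣n! p (2 * n))
    where instance _ = prime⇒nonZero pp

σ[2n+1]≡2σ[2n] : ∀ n → σ (2 * n + 1) ≡ 2 * σ (2 * n)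
σ[2n+1]≡2σ[2n] zero      = refl
σ[2n+1]≡2σ[2n] n@(suc _) = begin
  σ (2 * n + 1)                                       ≡⟨ cong σ (+-comm (2 * n) 1) ⟩
  primeProd (2 + 2 * n) (σExp (suc (2 * n)))          ≡⟨ primeProd-¬prime (suc (2 * n)) 2+2n-composite ⟩
  primeProd (suc (2 * n)) (σExp (suc (2 * n)))        ≡⟨ primeProd-suc-exponent prime[2] (suc (2 * n)) (s≤s (s≤s z≤n))
                                                           (σExp[1+n]2≡1+σExp[n]2 (2 * n))
                                                           (σExp[1+2n]≡σExp[2n] n) ⟩
  2 * σ (2 * n)                                       ∎
  where
  open ≡-Reasoning
  2+2n-composite : ¬ Prime (2 + 2 * n)
  2+2n-composite = ¬prime[2*m] (s≤s (s≤s z≤n)) ∘ subst Prime (sym (*-suc 2 n))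

proposition2 : ∀ (n : ℕ) →
    ((ρ n ∣ ρ (suc n)) × (σ n ∣ σ (suc n)) × (ρ n ∣ σ n))
    × (ρ n ∣ n !)
    × ((n ! ∣ σ n) × (σ n ∣ (2 * n) !))
    × (σ (2 * n + 1) ≡ 2 * σ (2 * n))
proposition2 n =
  (ρ∣ρ[1+n] n , σ∣σ[1+n] n , ρ∣σ n) , ρ∣n! n , (n!∣σ n , σ∣[2n]! n) , σ[2n+1]≡2σ[2n] n
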